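{- Let $T$ be a non ordinary numerical semigroup such that there exists $h\in\operatorname{SG}(T)$ with $h<\operatorname{m}(T)$, and let $y$ be a minimal generator of the numerical semigroup $T\cup\{h\}$ with $y\neq h$ such that: (i) if $T\cup\{h\}$ is irreducible, then $\frac{\operatorname{F}(T)}{2}<y<\operatorname{F}(T)$; (ii) if $T\cup\{h\}$ is not irreducible, then $\max\big(\operatorname{SG}(T\cup\{h\})\setminus\{\operatorname{F}(T)\}\big)<y<\operatorname{F}(T)$. Let $S=(T\cup\{h\})\setminus\{y\}$. Then $S$ is a non special numerical semigroup and $T=\mathcal{A}(S)$.
   Context: $\mathbb{N}=\{0,1,2,\ldots\}$. A numerical semigroup is a submonoid $S$ of $(\mathbb{N},+)$ with $\mathbb{N}\setminus S$ finite; a minimal generator is an element of $S\setminus\{0\}$ not expressible as a sum of two elements of $S\setminus\{0\}$. $\operatorname{H}(S)=\mathbb{N}\setminus S$; $\operatorname{F}(S)=\max\operatorname{H}(S)$; $\operatorname{m}(S)=\min(S\setminus\{0\})$. Special gaps: $\operatorname{SG}(S)=\{h\in\operatorname{H}(S)\mid 2h\in S \text{ and } h+s\in S \text{ for all } s\in S\setminus\{0\}\}$ (for $h\in\operatorname{SG}(T)$, $T\cup\{h\}$ is a numerical semigroup). $S$ is special if there is no $h\in\operatorname{SG}(S)\setminus\{\operatorname{F}(S)\}$ with $h>\operatorname{m}(S)$. $S$ is irreducible if it cannot be written as the intersection of two numerical semigroups properly containing $S$; $S$ is ordinary if $S=\{0\}\cup\{x\in\mathbb{N}\mid x\ge c\}$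 for some $c$. For non special $S$, $\mathcal{A}(S)=(S\cup\{h'\})\setminus\{\operatorname{m}(S)\}$ where $h'=\max(\operatorname{SG}(S)\setminus\{\operatorname{F}(S)\})$. -}

module Defs where

open import Data.Nat using (ℕ; zero; suc; _+_; _*_; _≤_; _<_; _≟_)
open import Data.Bool using (Bool; true; false; _∨_; _∧_; not)
open import Data.Product using (Σ; ∃; _×_; _,_)
open import Data.Sum using (_⊎_)
open import Data.Empty using (⊥)
open import Relation.Nullary using (¬_)
open import Relation.Nullary.Decidable using (⌊_⌋)
open import Relation.Binary.PropositionalEquality using (_≡_; _≢_)
open import Function.Bundles using (_⇔_)

NSet : Set
NSet = ℕ → Bool

infix 4 _∈_ _∉_
_∈_ : ℕ → NSet → Set
x ∈ S = S x ≡ true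

_∉_ : ℕ → NSet → Set
x ∉ S = ¬ (x ∈ S)

insert : ℕ → NSet → NSet
insert h S x = S x ∨ ⌊ x ≟ h ⌋

remove : ℕ → NSet → NSet
remove y S x = S x ∧ not ⌊ x ≟ y ⌋

_≐_ : NSet → NSet → Set
S ≐ T = ∀ x → S x ≡ T x

record IsNumericalSemigroup (S : NSet) : Set where
  field
    zero∈   : 0 ∈ S
    +-closed : ∀ x y → x ∈ S → y ∈ S → (x + y) ∈ S
    cofinite : ∃ λ c → ∀ x → c ≤ x → x ∈ S

IsMax : (ℕ → Set) → ℕ → Set
IsMax P g = P g × (∀ x → P x → x ≤ g)

IsMin : (ℕ → Set) → ℕ → Set
IsMin P g = P g × (∀ x → P x → g ≤ x)

IsFrobenius : NSet → ℕ → Set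
IsFrobenius S = IsMax (λ x → x ∉ S)

IsMultiplicity : NSet → ℕ → Set
IsMultiplicity S = IsMin (λ x → x ∈ S × x ≢ 0)

IsMinimalGenerator : NSet → ℕ → Set
IsMinimalGenerator S y =
  y ∈ S × y ≢ 0 ×
  ¬ (Σ ℕ λ a → Σ ℕ λ b → a ∈ S × a ≢ 0 × b ∈ S × b ≢ 0 × a + b ≡ y)

IsSpecialGap : NSet → ℕ → Set
IsSpecialGap S h = h ∉ S × (2 * h) ∈ S × (∀ s → s ∈ S → s ≢ 0 → (h + s) ∈ S)

Special : NSet → Set
Special S = ∀ f μ → IsFrobenius S f → IsMultiplicity S μ →
            ¬ (Σ ℕ λ g → IsSpecialGap S g × g ≢ f × μ < g)

ProperSuperset : NSet → NSet → Set
ProperSuperset S S₁ = (∀ x → x ∈ S → x ∈ S₁) × (∃ λ x → x ∈ S₁ × x ∉ S)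

Irreducible : NSet → Set
Irreducible S = ¬ (Σ NSet λ S₁ → Σ NSet λ S₂ →
    IsNumericalSemigroup S₁ × IsNumericalSemigroup S₂ ×
    ProperSuperset S S₁ × ProperSuperset S S₂ ×
    (∀ x → x ∈ S ⇔ (x ∈ S₁ × x ∈ S₂)))

Ordinary : NSet → Set
Ordinary S = ∃ λ c → ∀ x → x ∈ S ⇔ (x ≡ 0 ⊎ c ≤ x)

-- 𝒜(S) = (S ∪ {h'}) ∖ {m(S)} where h' is given and μ = m(S)
𝒜 : NSet → (μ h' : ℕ) → NSet
𝒜 S μ h' = remove μ (insert h' S)

{-# OPTIONS --safe #-}
-- Removing the minimal generator y from T ∪ {h} leaves a numerical semigroup S with Frobenius
-- number F = F(T), multiplicity h and y ∈ SG(S), h < y < F; so S is not special, and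
-- 𝒜(S) = (S ∪ {y}) ∖ {h} = T once y is shown to be the largest special gap of S other than F.
-- If g ∈ SG(S) ∖ {F} had g > y, then g (when g + y ∈ T ∪ {h}) or else g + y (when g + y ≠ F)
-- would be a special gap of T ∪ {h} other than F and above y: then T ∪ {h} is reducible and
-- (ii) fails. Finally g + y = F gives 2y < F, which (i) excludes if T ∪ {h} is irreducible;
-- otherwise T ∪ {h} has a special gap z ≠ F with F < 2z, while z < y by (ii).
module Submission where

open import Defs
open import Data.Nat using (ℕ; zero; suc; _+_; _*_; _∸_; _≤_; _<_; _≟_; _<?_; s≤s; s≤s⁻¹)
open import Data.Nat.Properties
open import Data.Nat.Induction using (<-rec)
open import Data.Bool using (true; false)
import Data.Bool.Properties as Bool
open import Data.Product using (Σ; _×_; _,_; proj₁; proj₂)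
open import Data.Sum using (_⊎_; inj₁; inj₂; [_,_]′)
open import Function using (_∘_; id)
open import Function.Bundles using (_⇔_; mk⇔; Equivalence)
open import Relation.Nullary using (¬_; Dec; yes; no; contradiction)
open import Relation.Nullary.Decidable using (map′; _×-dec_; _→-dec_; ¬?; decidable-stable)
open import Relation.Unary using (Decidable)
open import Relation.Binary.PropositionalEquality

_∈?_ : ∀ x S → Dec (x ∈ S)
x ∈? S = S x Bool.≟ true

∈-insert⁺ : ∀ S h {x} → x ∈ S → x ∈ insert h S
∈-insert⁺ S h x∈S rewrite x∈S = refl

∈-insert-self : ∀ S h → h ∈ insert h S
∈-insert-self S h with h ≟ h
... | yes _   = Bool.∨-zeroʳ (S h)
... | no h≢h = contradiction refl h≢h

∈-insert⁻ : ∀ S h {x} → x ∈ insert h S → x ∈ S ⊎ x ≡ h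
∈-insert⁻ S h {x} x∈ with S x | x ≟ h
... | true  | _        = inj₁ refl
... | false | yes x≡h = inj₂ x≡h
∈-insert⁻ S h () | false | no _

∉-insert : ∀ S h {x} → x ∉ S → x ≢ h → x ∉ insert h S
∉-insert S h x∉ x≢h = [ x∉ , x≢h ]′ ∘ ∈-insert⁻ S h

∈-remove⁺ : ∀ S y {x} → x ∈ S → x ≢ y → x ∈ remove y S
∈-remove⁺ S y {x} x∈ x≢y rewrite x∈ with x ≟ y
... | yes x≡y = contradiction x≡y x≢y
... | no _    = refl

∈-remove⁻ : ∀ S y {x} → x ∈ remove y S → x ∈ S × x ≢ y
∈-remove⁻ S y {x} x∈ with S x | x ≟ y
... | true | no x≢y = refl , x≢y
∈-remove⁻ S y () | true  | yes _
∈-remove⁻ S y () | false | _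

remove-insert-remove-insert : ∀ S {h y} → h ∉ S → y ∈ S → y ≢ h →
                              S ≐ remove h (insert y (remove y (insert h S)))
remove-insert-remove-insert S {h} {y} h∉ y∈ y≢h x with x ≟ h | x ≟ y | S x in Sx
... | yes refl | yes x≡y | _     = contradiction (sym x≡y) y≢h
... | yes refl | no _    | true  = contradiction Sx h∉
... | yes refl | no _    | false = refl
... | no _     | yes refl | true  = refl
... | no _     | yes refl | false = trans (sym Sx) y∈
... | no _     | no _    | true  = refl
... | no _     | no _    | false = refl

module _ {P : ℕ → Set} (P? : Decidable P) where

  greatest : ∀ B → (∀ x → P x → x < B) → ∀ {g} → P g → Σ ℕ (IsMax P)
  greatest zero    bound {g} Pg = contradiction (bound g Pg) λ ()
  greatest (suc B) bound Pg with P? B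
  ... | yes PB  = B , PB , λ x Px → s≤s⁻¹ (bound x Px)
  ... | no ¬PB = greatest B (λ x Px → ≤∧≢⇒< (s≤s⁻¹ (bound x Px)) λ { refl → ¬PB Px }) Pg

  least : ∀ {g} → P g → Σ ℕ (IsMin P)
  least {g} = <-rec (λ g → P g → Σ ℕ (IsMin P)) step g
    where
    step : ∀ g → (∀ {m} → m < g → P m → Σ ℕ (IsMin P)) → P g → Σ ℕ (IsMin P)
    step g rec Pg with anyUpTo? P? g
    ... | yes (m , m<g , Pm) = rec m<g Pm
    ... | no ∄m<g           = g , Pg , λ x Px → ≮⇒≥ λ x<g → ∄m<g (x , x<g , Px)

IsMax-unique : ∀ {P a b} → IsMax P a → IsMax P b → a ≡ b
IsMax-unique (Pa , a-max) (Pb , b-max) = ≤-antisym (b-max _ Pa) (a-max _ Pb)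

IsMin-unique : ∀ {P a b} → IsMin P a → IsMin P b → a ≡ b
IsMin-unique (Pa , a-min) (Pb , b-min) = ≤-antisym (a-min _ Pb) (b-min _ Pa)

2*m≡m+m : ∀ m → 2 * m ≡ m + m
2*m≡m+m m = cong (m +_) (+-identityʳ m)

m<2*m : ∀ {m} → m ≢ 0 → m < 2 * m
m<2*m {m} m≢0 = subst (m <_) (sym (2*m≡m+m m)) (m<m+n m (n≢0⇒n>0 m≢0))

m+n≢m : ∀ m {n} → n ≢ 0 → m + n ≢ m
m+n≢m m n≢0 m+n≡m = <-irrefl (sym m+n≡m) (m<m+n m (n≢0⇒n>0 n≢0))

F<⇒∈ : ∀ {S F x} → IsFrobenius S F → F < x → x ∈ S
F<⇒∈ {S} {F} {x} (_ , F-max) F<x with x ∈? S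
... | yes x∈ = x∈
... | no x∉  = contradiction (F-max x x∉) (<⇒≱ F<x)

frobenius-insert : ∀ {S F} h → IsFrobenius S F → F ≢ h → IsFrobenius (insert h S) F
frobenius-insert {S} h (F∉ , F-max) F≢h =
  ∉-insert S h F∉ F≢h , λ x x∉ → F-max x (x∉ ∘ ∈-insert⁺ S h)

frobenius-remove : ∀ {S F y} → IsFrobenius S F → y ≤ F → IsFrobenius (remove y S) F
frobenius-remove {S} {F} {y} (F∉ , F-max) y≤F = F∉ ∘ proj₁ ∘ ∈-remove⁻ S y , bound
  where
  bound : ∀ x → x ∉ remove y S → x ≤ F
  bound x x∉ with x ∈? S
  ... | no x∉S = F-max x x∉S
  ... | yes x∈ = ≮⇒≥ λ F<x → x∉ (∈-remove⁺ S y x∈ (>⇒≢ (≤-<-trans y≤F F<x)))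

IsSpecialGap-remove⁻ : ∀ {S y g} → IsSpecialGap (remove y S) g → g ≢ y → (g + y) ∈ S →
                       IsSpecialGap S g
IsSpecialGap-remove⁻ {S} {y} {g} (g∉ , 2g∈ , g+-∈) g≢y g+y∈ =
  (λ g∈ → g∉ (∈-remove⁺ S y g∈ g≢y)) , proj₁ (∈-remove⁻ S y 2g∈) , g+s∈
  where
  g+s∈ : ∀ s → s ∈ S → s ≢ 0 → (g + s) ∈ S
  g+s∈ s s∈ s≢0 with s ≟ y
  ... | yes refl = g+y∈
  ... | no s≢y   = proj₁ (∈-remove⁻ S y (g+-∈ s (∈-remove⁺ S y s∈ s≢y) s≢0))

F<m⇒ordinary : ∀ {S F μ} → IsNumericalSemigroup S → IsFrobenius S F → IsMultiplicity S μ →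
               F < μ → Ordinary S
F<m⇒ordinary {S} {F} isNS isF (_ , μ-min) F<μ = suc F , λ x → mk⇔ (to x) (from x)
  where
  to : ∀ x → x ∈ S → x ≡ 0 ⊎ suc F ≤ x
  to x x∈ with x ≟ 0
  ... | yes x≡0 = inj₁ x≡0
  ... | no x≢0  = inj₂ (<-≤-trans F<μ (μ-min x (x∈ , x≢0)))
  from : ∀ x → x ≡ 0 ⊎ suc F ≤ x → x ∈ S
  from _ (inj₁ refl) = IsNumericalSemigroup.zero∈ isNS
  from _ (inj₂ F<x)  = F<⇒∈ isF F<x

2*-closed : ∀ {S x} → IsNumericalSemigroup S → x ∈ S → (2 * x) ∈ S
2*-closed {S} {x} isNS x∈ = subst (_∈ S) (sym (2*m≡m+m x)) (+-closed x x x∈ x∈)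
  where open IsNumericalSemigroup isNS

-- Irreducible S unfolds to ¬ Decomposition S.
Decomposition : NSet → Set
Decomposition S = Σ NSet λ S₁ → Σ NSet λ S₂ →
    IsNumericalSemigroup S₁ × IsNumericalSemigroup S₂ ×
    ProperSuperset S S₁ × ProperSuperset S S₂ ×
    (∀ x → x ∈ S ⇔ (x ∈ S₁ × x ∈ S₂))

module NumericalSemigroup {S : NSet} (isNS : IsNumericalSemigroup S) where
  open IsNumericalSemigroup isNS

  c : ℕ
  c = proj₁ cofinite

  ∉⇒<c : ∀ {x} → x ∉ S → x < c
  ∉⇒<c {x} x∉ = ≰⇒> λ c≤x → x∉ (proj₂ cofinite x c≤x)

  ∉⇒≢0 : ∀ {x} → x ∉ S → x ≢ 0
  ∉⇒≢0 x∉ refl = x∉ zero∈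

  frobenius : ∀ {g} → g ∉ S → Σ ℕ (IsFrobenius S)
  frobenius = greatest (λ x → ¬? (x ∈? S)) c (λ _ → ∉⇒<c)

  multiplicity : Σ ℕ (IsMultiplicity S)
  multiplicity = least (λ x → x ∈? S ×-dec ¬? (x ≟ 0)) (proj₂ cofinite (suc c) (n≤1+n c) , λ ())

  special? : Decidable (IsSpecialGap S)
  special? x = map′ to from
    (¬? (x ∈? S) ×-dec (2 * x) ∈? S ×-dec allUpTo? (λ s → s ∈? S →-dec (¬? (s ≟ 0) →-dec (x + s) ∈? S)) c)
    where
    Translates-below-c : Set
    Translates-below-c = ∀ {s} → s < c → s ∈ S → s ≢ 0 → (x + s) ∈ S
    to : x ∉ S × (2 * x) ∈ S × Translates-below-c → IsSpecialGap S x
    to (x∉ , 2x∈ , below) = x∉ , 2x∈ , x+s∈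
      where
      x+s∈ : ∀ s → s ∈ S → s ≢ 0 → (x + s) ∈ S
      x+s∈ s with s <? c
      ... | yes s<c = below s<c
      ... | no s≮c  = λ _ _ → proj₂ cofinite (x + s) (≤-trans (≮⇒≥ s≮c) (m≤n+m s x))
    from : IsSpecialGap S x → x ∉ S × (2 * x) ∈ S × Translates-below-c
    from (x∉ , 2x∈ , x+-∈) = x∉ , 2x∈ , λ _ → x+-∈ _

  insert-isNumericalSemigroup : ∀ {g} → IsSpecialGap S g → IsNumericalSemigroup (insert g S)
  insert-isNumericalSemigroup {g} (_ , 2g∈ , g+-∈) = record
    { zero∈    = ∈-insert⁺ S g zero∈
    ; +-closed = closed
    ; cofinite = c , λ x c≤x → ∈-insert⁺ S g (proj₂ cofinite x c≤x)
    }
    where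
    g+s∈ : ∀ s → s ∈ S → (g + s) ∈ insert g S
    g+s∈ s s∈ with s ≟ 0
    ... | yes refl = subst (_∈ insert g S) (sym (+-identityʳ g)) (∈-insert-self S g)
    ... | no s≢0   = ∈-insert⁺ S g (g+-∈ s s∈ s≢0)
    closed : ∀ a b → a ∈ insert g S → b ∈ insert g S → (a + b) ∈ insert g S
    closed a b a∈ b∈ with ∈-insert⁻ S g a∈ | ∈-insert⁻ S g b∈
    ... | inj₁ a∈S | inj₁ b∈S = ∈-insert⁺ S g (+-closed a b a∈S b∈S)
    ... | inj₁ a∈S | inj₂ refl = subst (_∈ insert g S) (+-comm g a) (g+s∈ a a∈S)
    ... | inj₂ refl | inj₁ b∈S = g+s∈ b b∈S
    ... | inj₂ refl | inj₂ refl =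
      ∈-insert⁺ S g (subst (_∈ S) (2*m≡m+m g) 2g∈)

  +-∈-remove : ∀ {y s} → y ∈ S → s ∈ S → s ≢ 0 → (y + s) ∈ remove y S
  +-∈-remove {y} {s} y∈ s∈ s≢0 = ∈-remove⁺ S y (+-closed y s y∈ s∈) (m+n≢m y s≢0)

  remove-special-gap : ∀ {y} → y ∈ S → y ≢ 0 → IsSpecialGap (remove y S) y
  remove-special-gap {y} y∈ y≢0 =
    (λ y∈′ → proj₂ (∈-remove⁻ S y y∈′) refl) ,
    subst (_∈ remove y S) (sym (2*m≡m+m y)) (+-∈-remove y∈ y∈ y≢0) ,
    λ s s∈ → +-∈-remove y∈ (proj₁ (∈-remove⁻ S y s∈))

  remove-isNumericalSemigroup : ∀ {y} → IsMinimalGenerator S y → IsNumericalSemigroup (remove y S)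
  remove-isNumericalSemigroup {y} (y∈ , y≢0 , indecomposable) = record
    { zero∈    = ∈-remove⁺ S y zero∈ (y≢0 ∘ sym)
    ; +-closed = closed
    ; cofinite = suc y + c , λ x 1+y+c≤x →
        ∈-remove⁺ S y (proj₂ cofinite x (≤-trans (m≤n+m c (suc y)) 1+y+c≤x))
                      (>⇒≢ (≤-trans (m≤m+n (suc y) c) 1+y+c≤x))
    }
    where
    closed : ∀ a b → a ∈ remove y S → b ∈ remove y S → (a + b) ∈ remove y S
    closed a b a∈ b∈ with ∈-remove⁻ S y a∈ | ∈-remove⁻ S y b∈
    ... | a∈S , a≢y | b∈S , b≢y = ∈-remove⁺ S y (+-closed a b a∈S b∈S) a+b≢y
      where
      a+b≢y : a + b ≢ y
      a+b≢y a+b≡y with a ≟ 0 | b ≟ 0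
      ... | yes refl | _        = b≢y a+b≡y
      ... | no _     | yes refl = a≢y (trans (sym (+-identityʳ a)) a+b≡y)
      ... | no a≢0   | no b≢0   = indecomposable (a , b , a∈S , a≢0 , b∈S , b≢0 , a+b≡y)

  IsSpecialGap-remove-shift : ∀ {y g} → y ∈ S → y ≢ 0 → IsSpecialGap (remove y S) g →
                              (g + y) ∉ S → IsSpecialGap S (g + y)
  IsSpecialGap-remove-shift {y} {g} y∈ y≢0 (_ , 2g∈ , g+-∈) g+y∉ = g+y∉ , 2[g+y]∈ , g+y+s∈
    where
    2[g+y]∈ : (2 * (g + y)) ∈ S
    2[g+y]∈ = subst (_∈ S) (sym (*-distribˡ-+ 2 g y))
                (+-closed (2 * g) (2 * y) (proj₁ (∈-remove⁻ S y 2g∈)) (2*-closed isNS y∈))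
    g+y+s∈ : ∀ s → s ∈ S → s ≢ 0 → (g + y + s) ∈ S
    g+y+s∈ s s∈ s≢0 = subst (_∈ S) (sym (+-assoc g y s))
      (proj₁ (∈-remove⁻ S y (g+-∈ (y + s) (+-∈-remove y∈ s∈ s≢0) (y≢0 ∘ m+n≡0⇒m≡0 y))))

  -- The greatest element of S₁ ∖ S is a special gap of S.
  extension-special-gap : ∀ {S₁} → IsNumericalSemigroup S₁ → ProperSuperset S S₁ →
                          Σ ℕ λ z → IsSpecialGap S z × z ∈ S₁
  extension-special-gap {S₁} isNS₁ (S⊆S₁ , x , x∈S₁ , x∉S) with
    greatest (λ z → z ∈? S₁ ×-dec ¬? (z ∈? S)) c (λ _ → ∉⇒<c ∘ proj₂) (x∈S₁ , x∉S)
  ... | z , (z∈S₁ , z∉S) , z-max =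
    z , (z∉S , z<⇒∈ (2*-closed isNS₁ z∈S₁) (m<2*m (∉⇒≢0 z∉S)) , z+s∈) , z∈S₁
    where
    module S₁ = IsNumericalSemigroup isNS₁
    z<⇒∈ : ∀ {w} → w ∈ S₁ → z < w → w ∈ S
    z<⇒∈ {w} w∈S₁ z<w with w ∈? S
    ... | yes w∈S = w∈S
    ... | no w∉S  = contradiction (z-max w (w∈S₁ , w∉S)) (<⇒≱ z<w)
    z+s∈ : ∀ s → s ∈ S → s ≢ 0 → (z + s) ∈ S
    z+s∈ s s∈ s≢0 = z<⇒∈ (S₁.+-closed z s z∈S₁ (S⊆S₁ s s∈)) (m<m+n z (n≢0⇒n>0 s≢0))

  module _ {F} (isF : IsFrobenius S F) where
    private
      F∉ = proj₁ isF
      F-max = proj₂ isF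

    F-special : IsSpecialGap S F
    F-special = F∉ , F<⇒∈ isF (m<2*m (∉⇒≢0 F∉)) , λ s _ s≢0 → F<⇒∈ isF (m<m+n F (n≢0⇒n>0 s≢0))

    greatest-special-gap≢F : ∀ {u} → IsSpecialGap S u → u ≢ F →
                             Σ ℕ (IsMax (λ x → IsSpecialGap S x × x ≢ F))
    greatest-special-gap≢F u-sg u≢F =
      greatest (λ x → special? x ×-dec ¬? (x ≟ F)) (suc F)
               (λ x ((x∉ , _) , _) → s≤s (F-max x x∉)) (u-sg , u≢F)

    special-gap≢F⇒reducible : ∀ {u} → IsSpecialGap S u → u ≢ F → ¬ Irreducible S
    special-gap≢F⇒reducible {u} u-sg u≢F irreducible = irreducible
      ( insert u S , insert F S
      , insert-isNumericalSemigroup u-sg , insert-isNumericalSemigroup F-special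
      , proper u-sg , proper F-special
      , λ x → mk⇔ (λ x∈ → ∈-insert⁺ S u x∈ , ∈-insert⁺ S F x∈) (both x))
      where
      proper : ∀ {g} → IsSpecialGap S g → ProperSuperset S (insert g S)
      proper {g} (g∉ , _) = (λ _ → ∈-insert⁺ S g) , g , ∈-insert-self S g , g∉
      both : ∀ x → x ∈ insert u S × x ∈ insert F S → x ∈ S
      both x (x∈u , x∈F) with ∈-insert⁻ S u x∈u | ∈-insert⁻ S F x∈F
      ... | inj₁ x∈   | _          = x∈
      ... | inj₂ _    | inj₁ x∈    = x∈
      ... | inj₂ refl | inj₂ u≡F = contradiction u≡F u≢F

    decomposition⇒special-gap≢F : Decomposition S → Σ ℕ λ x → IsSpecialGap S x × x ≢ F
    decomposition⇒special-gap≢F (S₁ , S₂ , isNS₁ , isNS₂ , S⊂S₁ , S⊂S₂ , S≡S₁∩S₂)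
      with extension-special-gap isNS₁ S⊂S₁ | extension-special-gap isNS₂ S⊂S₂
    ... | z₁ , z₁-sg , z₁∈S₁ | z₂ , z₂-sg , z₂∈S₂ with z₁ ≟ F | z₂ ≟ F
    ... | no z₁≢F  | _         = z₁ , z₁-sg , z₁≢F
    ... | yes _    | no z₂≢F   = z₂ , z₂-sg , z₂≢F
    ... | yes refl | yes refl = contradiction (Equivalence.from (S≡S₁∩S₂ F) (z₁∈S₁ , z₂∈S₂)) F∉

    -- The greatest gap of the form w + k with k ∈ S is a special gap.
    complementary-gaps⇒special-gap-above-half : ∀ {x w} → x ∉ S → w ∉ S → x + w ≡ F → x < w →
                                 Σ ℕ λ z → IsSpecialGap S z × z ≢ F × F < 2 * z
    complementary-gaps⇒special-gap-above-half {x} {w} x∉ w∉ x+w≡F x<w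
      with greatest (λ k → k ∈? S ×-dec ¬? ((w + k) ∈? S)) (suc F)
                    (λ k (_ , w+k∉) → s≤s (≤-trans (m≤n+m k w) (F-max _ w+k∉)))
                    (zero∈ , subst (_∉ S) (sym (+-identityʳ w)) w∉)
    ... | k , (k∈ , w+k∉) , k-max = w + k , (w+k∉ , F<⇒∈ isF F<2[w+k] , w+k+s∈) , w+k≢F , F<2[w+k]
      where
      F<2[w+k] : F < 2 * (w + k)
      F<2[w+k] = begin-strict
        F                     ≡⟨ sym x+w≡F ⟩
        x + w                 <⟨ +-monoˡ-< w x<w ⟩
        w + w                 ≤⟨ +-mono-≤ (m≤m+n w k) (m≤m+n w k) ⟩
        w + k + (w + k)       ≡⟨ sym (2*m≡m+m (w + k)) ⟩
        2 * (w + k)           ∎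
        where open ≤-Reasoning
      w+k+s∈ : ∀ s → s ∈ S → s ≢ 0 → (w + k + s) ∈ S
      w+k+s∈ s s∈ s≢0 with (w + k + s) ∈? S
      ... | yes w+k+s∈S = w+k+s∈S
      ... | no w+k+s∉S  = contradiction
        (k-max (k + s) (+-closed k s k∈ s∈ , subst (_∉ S) (+-assoc w k s) w+k+s∉S))
        (<⇒≱ (m<m+n k (n≢0⇒n>0 s≢0)))
      w+k≢F : w + k ≢ F
      w+k≢F w+k≡F = x∉ (subst (_∈ S) k≡x k∈)
        where
        k≡x : k ≡ x
        k≡x = +-cancelˡ-≡ w k x (trans w+k≡F (trans (sym x+w≡F) (+-comm x w)))

    special-gap-above-half : ∀ {x} → IsSpecialGap S x → x ≢ F →
                             Σ ℕ λ z → IsSpecialGap S z × z ≢ F × F < 2 * z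
    special-gap-above-half {x} x-sg@(x∉ , 2x∈ , x+-∈) x≢F with F <? 2 * x
    ... | yes F<2x = x , x-sg , x≢F , F<2x
    ... | no F≮2x  = complementary-gaps⇒special-gap-above-half x∉ w∉ x+w≡F x<w
      where
      w : ℕ
      w = F ∸ x
      x+w≡F : x + w ≡ F
      x+w≡F = m+[n∸m]≡n (F-max x x∉)
      x<w : x < w
      x<w = +-cancelˡ-< x x w (subst₂ _<_ (2*m≡m+m x) (sym x+w≡F)
              (≤∧≢⇒< (≮⇒≥ F≮2x) λ 2x≡F → F∉ (subst (_∈ S) 2x≡F 2x∈)))
      w∉ : w ∉ S
      w∉ w∈ = F∉ (subst (_∈ S) x+w≡F (x+-∈ w w∈ (m<n⇒n≢0 x<w)))

module Lemma5p4
  (T : NSet) (isNS : IsNumericalSemigroup T) (non-ordinary : ¬ Ordinary T)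
  (h : ℕ) (h-special : IsSpecialGap T h) (h<m : ∀ μT → IsMultiplicity T μT → h < μT)
  (y : ℕ) (y-generator : IsMinimalGenerator (insert h T) y) (y≢h : y ≢ h)
  (bounds : ∀ fT → IsFrobenius T fT →
    (Irreducible (insert h T) → fT < 2 * y × y < fT) ×
    (¬ Irreducible (insert h T) →
      (∀ g → IsMax (λ x → IsSpecialGap (insert h T) x × x ≢ fT) g → g < y) × y < fT))
  where

  T′ : NSet
  T′ = insert h T

  S : NSet
  S = remove y T′

  module T = NumericalSemigroup isNS

  isNS′ : IsNumericalSemigroup T′
  isNS′ = T.insert-isNumericalSemigroup h-special

  module T′ = NumericalSemigroup isNS′

  F : ℕ
  F = proj₁ (T.frobenius (proj₁ h-special))

  isF : IsFrobenius T F
  isF = proj₂ (T.frobenius (proj₁ h-special))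

  μ : ℕ
  μ = proj₁ T.multiplicity

  isμ : IsMultiplicity T μ
  isμ = proj₂ T.multiplicity

  h<nonzero : ∀ {x} → x ∈ T → x ≢ 0 → h < x
  h<nonzero x∈ x≢0 = <-≤-trans (h<m μ isμ) (proj₂ isμ _ (x∈ , x≢0))

  F≢h : F ≢ h
  F≢h F≡h = non-ordinary (F<m⇒ordinary isNS isF isμ (subst (_< μ) (sym F≡h) (h<m μ isμ)))

  isF′ : IsFrobenius T′ F
  isF′ = frobenius-insert h isF F≢h

  irreducible-bounds : Irreducible T′ → F < 2 * y × y < F
  irreducible-bounds = proj₁ (bounds F isF)

  reducible-bounds : ¬ Irreducible T′ →
    (∀ g → IsMax (λ x → IsSpecialGap T′ x × x ≢ F) g → g < y) × y < F
  reducible-bounds = proj₂ (bounds F isF)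

  y∈T′ : y ∈ T′
  y∈T′ = proj₁ y-generator

  y≢0 : y ≢ 0
  y≢0 = proj₁ (proj₂ y-generator)

  y∈T : y ∈ T
  y∈T = [ id , (λ y≡h → contradiction y≡h y≢h) ]′ (∈-insert⁻ T h y∈T′)

  h<y : h < y
  h<y = h<nonzero y∈T y≢0

  -- Irreducibility is not decidable, so the case split on it happens under ¬¬.
  y<F : y < F
  y<F = decidable-stable (y <? F) λ y≮F →
    y≮F (proj₂ (reducible-bounds λ irreducible → y≮F (proj₂ (irreducible-bounds irreducible))))

  special-gap<y : ∀ {u} → IsSpecialGap T′ u → u ≢ F → u < y
  special-gap<y u-sg u≢F with T′.greatest-special-gap≢F isF′ u-sg u≢F
  ... | M , isM = ≤-<-trans (proj₂ isM _ (u-sg , u≢F))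
                            (proj₁ (reducible-bounds (T′.special-gap≢F⇒reducible isF′ u-sg u≢F)) M isM)

  F≤y+y : F ≤ y + y
  F≤y+y = ≮⇒≥ λ y+y<F → reducible y+y<F λ decomposition →
    let x , x-sg , x≢F = T′.decomposition⇒special-gap≢F isF′ decomposition
        z , z-sg , z≢F , F<2z = T′.special-gap-above-half isF′ x-sg x≢F
        z<y = special-gap<y z-sg z≢F
    in <-asym F<2z (subst (_< F) (sym (2*m≡m+m z)) (<-trans (+-mono-< z<y z<y) y+y<F))
    where
    reducible : y + y < F → ¬ Irreducible T′
    reducible y+y<F irreducible =
      <-asym (proj₁ (irreducible-bounds irreducible)) (subst (_< F) (sym (2*m≡m+m y)) y+y<F)

  special-gap≤y : ∀ {g} → IsSpecialGap S g → g ≢ F → g ≤ y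
  special-gap≤y {g} g-sg g≢F = ≮⇒≥ y≮g
    where
    y≮g : ¬ y < g
    y≮g y<g with (g + y) ∈? T′
    ... | yes g+y∈ = <-asym y<g (special-gap<y (IsSpecialGap-remove⁻ g-sg (>⇒≢ y<g) g+y∈) g≢F)
    ... | no g+y∉ with g + y ≟ F
    ...   | no g+y≢F  = <⇒≱ (special-gap<y (T′.IsSpecialGap-remove-shift y∈T′ y≢0 g-sg g+y∉) g+y≢F)
                            (m≤n+m y g)
    ...   | yes g+y≡F = <⇒≱ (subst (y + y <_) g+y≡F (+-monoˡ-< y y<g)) F≤y+y

  S-isNumericalSemigroup : IsNumericalSemigroup S
  S-isNumericalSemigroup = T′.remove-isNumericalSemigroup y-generator

  isF-S : IsFrobenius S F
  isF-S = frobenius-remove isF′ (<⇒≤ y<F)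

  isμ-S : IsMultiplicity S h
  isμ-S = (∈-remove⁺ T′ y (∈-insert-self T h) (y≢h ∘ sym) , T.∉⇒≢0 (proj₁ h-special)) , h-min
    where
    h-min : ∀ x → x ∈ S × x ≢ 0 → h ≤ x
    h-min x (x∈ , x≢0) = [ (λ x∈T → <⇒≤ (h<nonzero x∈T x≢0)) , (λ { refl → ≤-refl }) ]′
                           (∈-insert⁻ T h (proj₁ (∈-remove⁻ T′ y x∈)))

  y-special : IsSpecialGap S y
  y-special = T′.remove-special-gap y∈T′ y≢0

  y-greatest : IsMax (λ x → IsSpecialGap S x × x ≢ F) y
  y-greatest = (y-special , <⇒≢ y<F) , λ g (g-sg , g≢F) → special-gap≤y g-sg g≢F

  S-not-special : ¬ Special S
  S-not-special special = special F h isF-S isμ-S (y , y-special , <⇒≢ y<F , h<y)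

  T≐𝒜[S] : ∀ f μ′ h′ → IsFrobenius S f → IsMultiplicity S μ′ →
           IsMax (λ x → IsSpecialGap S x × x ≢ f) h′ → T ≐ 𝒜 S μ′ h′
  T≐𝒜[S] f μ′ h′ isf isμ′ isMax
    with IsMax-unique isF-S isf | IsMin-unique isμ-S isμ′
  ... | refl | refl with IsMax-unique y-greatest isMax
  ... | refl = remove-insert-remove-insert T (proj₁ h-special) y∈T y≢h

lemma5p4 : (T : NSet) → IsNumericalSemigroup T → ¬ Ordinary T →
    (h : ℕ) → IsSpecialGap T h → (∀ μT → IsMultiplicity T μT → h < μT) →
    (y : ℕ) → IsMinimalGenerator (insert h T) y → y ≢ h →
    (∀ fT → IsFrobenius T fT →
      (Irreducible (insert h T) → fT < 2 * y × y < fT) ×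
      (¬ Irreducible (insert h T) →
        (∀ g → IsMax (λ x → IsSpecialGap (insert h T) x × x ≢ fT) g → g < y) × y < fT)) →
    IsNumericalSemigroup (remove y (insert h T)) × ¬ Special (remove y (insert h T)) ×
    (∀ f μ h' → IsFrobenius (remove y (insert h T)) f →
      IsMultiplicity (remove y (insert h T)) μ →
      IsMax (λ x → IsSpecialGap (remove y (insert h T)) x × x ≢ f) h' →
      T ≐ 𝒜 (remove y (insert h T)) μ h')
lemma5p4 T isNS non-ordinary h h-special h<m y y-generator y≢h bounds =
  S-isNumericalSemigroup , S-not-special , T≐𝒜[S]
  where open Lemma5p4 T isNS non-ordinary h h-special h<m y y-generator y≢h bounds
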